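{- Suppose $P$ is an $n$-element poset, and that $P$ has exactly two $m$-element ideals, for each $m\in\{1,\dots,n-1\}$. Then $P$ is a $2$-chain.
   Context: All posets are finite; partial orders are written $\preceq$. A poset $(P,\preceq)$ is a $2$-chain if (1) there is a unique way to write $P$ as the union of two chains, and (2) $\preceq$ is maximal subject to (1), i.e. for every proper refinement $\preceq^+$ of $\preceq$ there is more than one way to write $P$ as the union of two $\preceq^+$-chains. An ideal (down-set) of $P$ is a subset $Q$ such that $p\not\preceq q$ whenever $q\in Q$ and $p\in P\setminus Q$. -}

module Defs where

open import Data.Nat using (ℕ; _≤_; _<_)
open import Data.Fin using (Fin)
open import Data.Fin.Subset using (Subset; _∈_; _∉_; ∣_∣)
open import Data.Bool using (Bool; not)
open import Data.Product using (Σ; ∃; ∃-syntax; _×_; _,_)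
open import Data.Sum using (_⊎_)
open import Relation.Nullary using (¬_)
open import Relation.Binary.Core using (Rel)
open import Relation.Binary.Definitions using (Decidable)
open import Relation.Binary.Structures using (IsPartialOrder)
open import Relation.Binary.PropositionalEquality using (_≡_; _≢_)

-- A finite poset on the n-element carrier Fin n (finite orders are decidable).
record FinPoset (n : ℕ) : Set₁ where
  field
    _≼_ : Rel (Fin n) _
    isPartialOrder : IsPartialOrder _≡_ _≼_
    _≼?_ : Decidable _≼_
open FinPoset public

IsIdeal : ∀ {n} → FinPoset n → Subset n → Set
IsIdeal P Q = ∀ p q → q ∈ Q → p ∉ Q → ¬ (_≼_ P p q)

IsIdealOfSize : ∀ {n} → FinPoset n → ℕ → Subset n → Set
IsIdealOfSize P m Q = IsIdeal P Q × ∣ Q ∣ ≡ m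

ExactlyTwoIdealsOfSize : ∀ {n} → FinPoset n → ℕ → Set
ExactlyTwoIdealsOfSize {n} P m =
  Σ (Subset n) λ Q₁ → Σ (Subset n) λ Q₂ →
    Q₁ ≢ Q₂ × IsIdealOfSize P m Q₁ × IsIdealOfSize P m Q₂ ×
    (∀ Q → IsIdealOfSize P m Q → Q ≡ Q₁ ⊎ Q ≡ Q₂)

-- A way of writing P as the union of two chains, encoded as a 2-colouring of
-- the elements whose colour classes are chains (the two chains are the colour
-- classes; they are disjoint and may be empty).
IsTwoChainCover : ∀ {n} → FinPoset n → (Fin n → Bool) → Set
IsTwoChainCover P c = ∀ x y → c x ≡ c y → _≼_ P x y ⊎ _≼_ P y x

-- Two colourings give the same (unordered) pair of chains iff they agree or
-- are swaps of each other.
SameCover : ∀ {n} → (Fin n → Bool) → (Fin n → Bool) → Set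
SameCover c c' = (∀ x → c' x ≡ c x) ⊎ (∀ x → c' x ≡ not (c x))

UniqueTwoChainCover : ∀ {n} → FinPoset n → Set
UniqueTwoChainCover P =
  Σ _ λ c → IsTwoChainCover P c × (∀ c' → IsTwoChainCover P c' → SameCover c c')

SeveralTwoChainCovers : ∀ {n} → FinPoset n → Set
SeveralTwoChainCovers P =
  Σ _ λ c → Σ _ λ c' → IsTwoChainCover P c × IsTwoChainCover P c' × ¬ SameCover c c'

IsProperRefinement : ∀ {n} → FinPoset n → FinPoset n → Set
IsProperRefinement P Q =
  (∀ x y → _≼_ P x y → _≼_ Q x y) × (∃[ x ] ∃[ y ] (_≼_ Q x y × ¬ _≼_ P x y))

IsTwoChain : ∀ {n} → FinPoset n → Set₁
IsTwoChain {n} P =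
  UniqueTwoChainCover P ×
  (∀ (Q : FinPoset n) → IsProperRefinement P Q → SeveralTwoChainCovers Q)

{-# OPTIONS --safe #-}
module Submission where

-- Let Uₘ be the union of the two ideals of size m.  Exchanging a maximal element of
-- B ∖ A for a minimal element of A ∖ B turns one such ideal B into the other one A,
-- so ∣ Uₘ ∣ = m + 1 and U₁ ⊂ U₂ ⊂ ⋯ ⊂ Uₙ₋₁ = P grow by one element z at a time.
-- That z is incomparable to exactly one w ∈ Uₘ: for incomparable w and z the ideals
-- ↓w ∪ (↓z − z) and ↓z ∪ (↓w − w) have the same size, so they are the two ideals of
-- that size, and comparing this size with m forces Uₘ = ↓w ∪ (↓z − z).  Hence the
-- incomparability graph is a tree grown leaf by leaf.  Covers of P by two chains are
-- its proper 2-colourings, unique up to swapping for a tree; a proper refinement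
-- adding x ≼ y deletes the edge xy, a bridge, and recolouring one side of it gives
-- a second cover.

open import Defs
open import Data.Bool.Base using (Bool; true; false; not)
open import Data.Bool.Properties using (not-¬; ¬-not)
open import Data.Empty using (⊥-elim)
open import Data.Fin.Base using (Fin; zero; suc)
open import Data.Fin.Induction using (po-wellFounded; po-noetherian)
open import Data.Fin.Properties using (any?; _≟_)
open import Data.Fin.Subset
  using (Subset; inside; outside; _∈_; _∉_; _⊆_; _⊈_; ∣_∣; ⊤; ⊥; ⁅_⁆; _∪_; _─_; _-_)
open import Data.Fin.Subset.Properties
  using (_∈?_; _⊆?_; ⊆-refl; ⊆-trans; ⊆-antisym; p⊆p∪q; q⊆p∪q; x∈p∪q⁻; ∪-assoc; ∪-comm; ∪-identityʳ;
         x∈⁅x⁆; x∈⁅y⁆⇒x≡y; x∉⁅y⁆⇒x≢y; ∣⁅x⁆∣≡1; ∉⊥; ⊥⊆; ∣⊥∣≡0; ∈⊤; ⊆⊤; ∣⊤∣≡n; ∣p∣≡n⇒p≡⊤;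
         p─q⊆p; x∈p∧x≢y⇒x∈p-y; p⊆q⇒∣p∣≤∣q∣; p⊂q⇒∣p∣<∣q∣)
open import Data.Nat.Base using (ℕ; zero; suc; _≤_; _<_; _≤′_; ≤′-refl; ≤′-step; z≤n; s≤s)
open import Data.Nat.Properties
  using (≤⇒≯; ≤-reflexive; ≤-<-trans; <⇒≤; <-irrefl; <-trans; <-cmp; n<1+n; ≤-refl; ≤-trans; ≤⇒≤′; ≤′⇒≤; _≤?_; _<?_)
open import Data.Product.Base using (∃; _×_; _,_; proj₁)
open import Data.Sum.Base using (_⊎_; inj₁; inj₂; [_,_]′)
open import Data.Vec.Base using (_∷_; here; there; tabulate)
open import Data.Vec.Functional using (updateAt)
open import Data.Vec.Functional.Properties using (updateAt-updates; updateAt-minimal)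
open import Data.Vec.Properties using (lookup∘tabulate; lookup⇒[]=; []=⇒lookup)
open import Function.Base using (_∘_; const; flip)
open import Induction.WellFounded using (WellFounded; Acc; acc)
open import Level using (Level; 0ℓ)
open import Relation.Binary.Core using (Rel; _⇒_)
open import Relation.Binary.Definitions using (Symmetric; Decidable; Tri; tri<; tri≈; tri>)
open import Relation.Binary.Structures using (IsPartialOrder)
open import Relation.Binary.PropositionalEquality
  using (_≡_; _≢_; refl; sym; trans; cong; subst; ≢-sym; module ≡-Reasoning)
import Relation.Binary.Construct.NonStrictToStrict as ToStrict
open import Relation.Nullary.Decidable
  using (Dec; yes; no; does; ¬?; _×-dec_; decidable-stable; dec-true; dec-false; recompute)
open import Relation.Nullary.Negation using (¬_; contradiction)
open import Relation.Unary using (Pred) renaming (Decidable to DecidablePred)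

x∉p⇒∣p∪⁅x⁆∣≡1+∣p∣ : ∀ {n} {p : Subset n} {x} → x ∉ p → ∣ p ∪ ⁅ x ⁆ ∣ ≡ suc ∣ p ∣
x∉p⇒∣p∪⁅x⁆∣≡1+∣p∣ {p = outside ∷ p} {zero} _ = cong suc (cong ∣_∣ (∪-identityʳ p))
x∉p⇒∣p∪⁅x⁆∣≡1+∣p∣ {p = inside ∷ p} {zero} x∉p = contradiction here x∉p
x∉p⇒∣p∪⁅x⁆∣≡1+∣p∣ {p = outside ∷ p} {suc x} x∉p = x∉p⇒∣p∪⁅x⁆∣≡1+∣p∣ (x∉p ∘ there)
x∉p⇒∣p∪⁅x⁆∣≡1+∣p∣ {p = inside ∷ p} {suc x} x∉p = cong suc (x∉p⇒∣p∪⁅x⁆∣≡1+∣p∣ (x∉p ∘ there))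

x∈p─q⇒x∉q : ∀ {n} {p q : Subset n} {x} → x ∈ p ─ q → x ∉ q
x∈p─q⇒x∉q {p = _ ∷ p} {outside ∷ q} here ()
x∈p─q⇒x∉q {p = _ ∷ p} {_ ∷ q} (there x∈p─q) (there x∈q) = x∈p─q⇒x∉q x∈p─q x∈q

module _ {n : ℕ} where

  p⊈q⇒∃x∈p∖q : {p q : Subset n} → p ⊈ q → ∃ λ x → x ∈ p × x ∉ q
  p⊈q⇒∃x∈p∖q {p} {q} p⊈q with any? (λ x → x ∈? p ×-dec ¬? (x ∈? q))
  ... | yes witness = witness
  ... | no none = ⊥-elim (p⊈q λ {x} x∈p →
    decidable-stable (x ∈? q) (λ x∉q → none (x , x∈p , x∉q)))

  p⊆q∧∣q∣≤∣p∣⇒p≡q : {p q : Subset n} → p ⊆ q → ∣ q ∣ ≤ ∣ p ∣ → p ≡ q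
  p⊆q∧∣q∣≤∣p∣⇒p≡q {p} {q} p⊆q ∣q∣≤∣p∣ with q ⊆? p
  ... | yes q⊆p = ⊆-antisym p⊆q q⊆p
  ... | no q⊈p = contradiction (p⊂q⇒∣p∣<∣q∣ (p⊆q , p⊈q⇒∃x∈p∖q q⊈p)) (≤⇒≯ ∣q∣≤∣p∣)

  ∣p∣≡∣q∣∧p≢q⇒∃x∈p∖q : {p q : Subset n} → ∣ p ∣ ≡ ∣ q ∣ → p ≢ q → ∃ λ x → x ∈ p × x ∉ q
  ∣p∣≡∣q∣∧p≢q⇒∃x∈p∖q {p} {q} ∣p∣≡∣q∣ p≢q with p ⊆? q
  ... | yes p⊆q = contradiction (p⊆q∧∣q∣≤∣p∣⇒p≡q p⊆q (≤-reflexive (sym ∣p∣≡∣q∣))) p≢q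
  ... | no p⊈q = p⊈q⇒∃x∈p∖q p⊈q

  x∈p⇒0<∣p∣ : ∀ {p : Subset n} {x} → x ∈ p → 0 < ∣ p ∣
  x∈p⇒0<∣p∣ {p} {x} x∈p = subst (_< ∣ p ∣) (∣⊥∣≡0 n) (p⊂q⇒∣p∣<∣q∣ (⊥⊆ , x , x∈p , ∉⊥))

  x∉p⇒∣p∣<n : ∀ {p : Subset n} {x} → x ∉ p → ∣ p ∣ < n
  x∉p⇒∣p∣<n {p} {x} x∉p = subst (∣ p ∣ <_) (∣⊤∣≡n n) (p⊂q⇒∣p∣<∣q∣ (⊆⊤ , x , ∈⊤ , x∉p))

  x∈p∪⁅y⁆⇒x∈p⊎x≡y : ∀ {p : Subset n} {x y} → x ∈ p ∪ ⁅ y ⁆ → x ∈ p ⊎ x ≡ y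
  x∈p∪⁅y⁆⇒x∈p⊎x≡y {p} {y = y} x∈p∪y with x∈p∪q⁻ p ⁅ y ⁆ x∈p∪y
  ... | inj₁ x∈p = inj₁ x∈p
  ... | inj₂ x∈y = inj₂ (x∈⁅y⁆⇒x≡y y x∈y)

  p⊆q∧y∈q⇒p∪⁅y⁆⊆q : ∀ {p q : Subset n} {y} → p ⊆ q → y ∈ q → p ∪ ⁅ y ⁆ ⊆ q
  p⊆q∧y∈q⇒p∪⁅y⁆⊆q p⊆q y∈q x∈p∪y with x∈p∪⁅y⁆⇒x∈p⊎x≡y x∈p∪y
  ... | inj₁ x∈p = p⊆q x∈p
  ... | inj₂ refl = y∈q

  x∉p-x : ∀ (p : Subset n) x → x ∉ p - x
  x∉p-x p x x∈p-x = x∈p─q⇒x∉q x∈p-x (x∈⁅x⁆ x)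

  x∈p⇒p≡p-x∪⁅x⁆ : ∀ {p : Subset n} {x} → x ∈ p → p ≡ (p - x) ∪ ⁅ x ⁆
  x∈p⇒p≡p-x∪⁅x⁆ {p} {x} x∈p = ⊆-antisym split (p⊆q∧y∈q⇒p∪⁅y⁆⊆q (p─q⊆p p ⁅ x ⁆) x∈p)
    where
    split : p ⊆ (p - x) ∪ ⁅ x ⁆
    split {y} y∈p with y ≟ x
    ... | yes refl = q⊆p∪q (p - x) ⁅ x ⁆ (x∈⁅x⁆ x)
    ... | no y≢x = p⊆p∪q ⁅ x ⁆ (x∈p∧x≢y⇒x∈p-y y∈p y≢x)

  x∈p⇒∣p∣≡1+∣p-x∣ : ∀ {p : Subset n} {x} → x ∈ p → ∣ p ∣ ≡ suc ∣ p - x ∣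
  x∈p⇒∣p∣≡1+∣p-x∣ {p} {x} x∈p =
    trans (cong ∣_∣ (x∈p⇒p≡p-x∪⁅x⁆ x∈p)) (x∉p⇒∣p∪⁅x⁆∣≡1+∣p∣ (x∉p-x p x))

  p⊆q∧∣q∣≡1+∣p∣⇒q≡p∪⁅x⁆ : ∀ {p q : Subset n} → p ⊆ q → ∣ q ∣ ≡ suc ∣ p ∣ →
    ∃ λ x → x ∉ p × q ≡ p ∪ ⁅ x ⁆
  p⊆q∧∣q∣≡1+∣p∣⇒q≡p∪⁅x⁆ {p} {q} p⊆q ∣q∣≡1+∣p∣ with q ⊆? p
  ... | yes q⊆p = contradiction (≤-reflexive (sym ∣q∣≡1+∣p∣)) (≤⇒≯ (p⊆q⇒∣p∣≤∣q∣ q⊆p))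
  ... | no q⊈p with p⊈q⇒∃x∈p∖q q⊈p
  ...   | x , x∈q , x∉p = x , x∉p , sym (p⊆q∧∣q∣≤∣p∣⇒p≡q (p⊆q∧y∈q⇒p∪⁅y⁆⊆q p⊆q x∈q)
          (≤-reflexive (trans ∣q∣≡1+∣p∣ (sym (x∉p⇒∣p∪⁅x⁆∣≡1+∣p∣ x∉p)))))

  module _ {ℓ} {A : Pred (Fin n) ℓ} (A? : DecidablePred A) where

    subsetOf : Subset n
    subsetOf = tabulate (does ∘ A?)

    ∈subsetOf⁺ : ∀ {x} → A x → x ∈ subsetOf
    ∈subsetOf⁺ {x} ax = lookup⇒[]= x subsetOf (trans (lookup∘tabulate (does ∘ A?) x) (dec-true (A? x) ax))

    ∈subsetOf⁻ : ∀ {x} → x ∈ subsetOf → A x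
    ∈subsetOf⁻ {x} x∈ = decidable-stable (A? x) λ ¬ax → contradiction
      (trans (sym ([]=⇒lookup x∈)) (trans (lookup∘tabulate (does ∘ A?) x) (dec-false (A? x) ¬ax)))
      λ ()

minimal : ∀ {n r s} {_<_ : Rel (Fin n) r} {S : Pred (Fin n) s} → WellFounded _<_ → Decidable _<_ →
  DecidablePred S → ∀ {x} → S x → ∃ λ a → S a × ∀ {y} → S y → ¬ y < a
minimal {_<_ = _<_} {S} wf _<?_ S? {x} = go (wf x)
  where
  go : ∀ {x} → Acc _<_ x → S x → ∃ λ a → S a × ∀ {y} → S y → ¬ y < a
  go {x} (acc below) Sx with any? (λ y → S? y ×-dec y <? x)
  ... | yes (y , Sy , y<x) = go (below y<x) Sy
  ... | no none = x , Sx , λ Sy y<x → none (_ , Sy , y<x)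

Colouring : ℕ → Set
Colouring n = Fin n → Bool

module _ {n : ℕ} where

  ProperOn : ∀ {ℓ} → Rel (Fin n) ℓ → Subset n → Colouring n → Set ℓ
  ProperOn _#_ U c = ∀ {x y} → x ∈ U → y ∈ U → x # y → c x ≢ c y

  SameOn : Subset n → Colouring n → Colouring n → Set
  SameOn U c c' = (∀ {x} → x ∈ U → c' x ≡ c x) ⊎ (∀ {x} → x ∈ U → c' x ≡ not (c x))

  withoutEdge : ∀ {ℓ} → Rel (Fin n) ℓ → Fin n → Fin n → Rel (Fin n) ℓ
  withoutEdge _#_ x y u v = u # v × ¬ (u ≡ x × v ≡ y) × ¬ (u ≡ y × v ≡ x)

  ProperOn-⊆ : ∀ {ℓ} {R : Rel (Fin n) ℓ} {U V c} → U ⊆ V → ProperOn R V c → ProperOn R U c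
  ProperOn-⊆ U⊆V proper x∈U y∈U = proper (U⊆V x∈U) (U⊆V y∈U)

  ProperOn-⇒ : ∀ {ℓ ℓ'} {R : Rel (Fin n) ℓ} {R' : Rel (Fin n) ℓ'} {U c} →
    R' ⇒ R → ProperOn R U c → ProperOn R' U c
  ProperOn-⇒ R'⇒R proper x∈U y∈U xR'y = proper x∈U y∈U (R'⇒R xR'y)

  SameOn-⊤⇒SameCover : ∀ {c c'} → SameOn ⊤ c c' → SameCover c c'
  SameOn-⊤⇒SameCover (inj₁ same) = inj₁ λ _ → same ∈⊤
  SameOn-⊤⇒SameCover (inj₂ swapped) = inj₂ λ _ → swapped ∈⊤

  SameCover⇒SameOn-⊤ : ∀ {c c'} → SameCover c c' → SameOn ⊤ c c'
  SameCover⇒SameOn-⊤ (inj₁ same) = inj₁ λ {x} _ → same x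
  SameCover⇒SameOn-⊤ (inj₂ swapped) = inj₂ λ {x} _ → swapped x

  -- U induces a tree, recorded as what the cover argument uses: a proper
  -- 2-colouring, unique up to swapping (connectedness), and for every edge a
  -- second colouring once that edge is deleted (every edge is a bridge).
  module _ {ℓ} (_#_ : Rel (Fin n) ℓ) where

    record Tree (U : Subset n) : Set ℓ where
      field
        colouring : Colouring n
        proper : ProperOn _#_ U colouring
        unique : ∀ c → ProperOn _#_ U c → SameOn U colouring c
        bridge : ∀ {x y} → x ∈ U → y ∈ U → x # y →
          ∃ λ c → ProperOn (withoutEdge _#_ x y) U c × ¬ SameOn U colouring c

    record LeafExtension (U U' : Subset n) : Set ℓ where
      field
        leaf stem : Fin n
        leaf∉U : leaf ∉ U
        U'≡U∪leaf : U' ≡ U ∪ ⁅ leaf ⁆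
        stem∈U : stem ∈ U
        stem#leaf : stem # leaf
        stem-unique : ∀ {v} → v ∈ U → v # leaf → v ≡ stem

    Tree-⊥ : Tree ⊥
    Tree-⊥ = record
      { colouring = const false
      ; proper = λ x∈⊥ → contradiction x∈⊥ ∉⊥
      ; unique = λ _ _ → inj₁ λ x∈⊥ → contradiction x∈⊥ ∉⊥
      ; bridge = λ x∈⊥ → contradiction x∈⊥ ∉⊥
      }

module TreeGrowth {n : ℕ} {ℓ : Level} {_#_ : Rel (Fin n) ℓ}
  (#-sym : Symmetric _#_) (#-irrefl : ∀ {x} → ¬ x # x) where

  Tree-⁅⁆ : ∀ a → Tree _#_ ⁅ a ⁆
  Tree-⁅⁆ a = record
    { colouring = const false
    ; proper = λ x∈ y∈ x#y _ → no-edge x∈ y∈ x#y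
    ; unique = unique
    ; bridge = λ x∈ y∈ x#y → ⊥-elim (no-edge x∈ y∈ x#y)
    }
    where
    no-edge : ∀ {x y} → x ∈ ⁅ a ⁆ → y ∈ ⁅ a ⁆ → ¬ x # y
    no-edge x∈ y∈ x#y with refl ← x∈⁅y⁆⇒x≡y a x∈ | refl ← x∈⁅y⁆⇒x≡y a y∈ = #-irrefl x#y
    unique : ∀ c → ProperOn _#_ ⁅ a ⁆ c → SameOn ⁅ a ⁆ (const false) c
    unique c _ with c a in ca
    ... | false = inj₁ λ x∈ → trans (cong c (x∈⁅y⁆⇒x≡y a x∈)) ca
    ... | true = inj₂ λ x∈ → trans (cong c (x∈⁅y⁆⇒x≡y a x∈)) ca

  withoutEdge-sym : ∀ {x y} → Symmetric (withoutEdge _#_ x y)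
  withoutEdge-sym (u#v , ¬xy , ¬yx) =
    #-sym u#v , (λ (v≡x , u≡y) → ¬yx (u≡y , v≡x)) , (λ (v≡y , u≡x) → ¬xy (u≡x , v≡y))

  not-b≢b : ∀ {b} → not b ≢ b
  not-b≢b e = not-¬ refl (sym e)

  module AddLeaf {U : Subset n} {z w : Fin n} (T : Tree _#_ U) (z∉U : z ∉ U) (w∈U : w ∈ U)
    (w#z : w # z) (w-unique : ∀ {v} → v ∈ U → v # z → v ≡ w) where

    open Tree T
    open ≡-Reasoning

    U' : Subset n
    U' = U ∪ ⁅ z ⁆

    U⊆U' : U ⊆ U'
    U⊆U' = p⊆p∪q ⁅ z ⁆

    z∈U' : z ∈ U'
    z∈U' = q⊆p∪q U ⁅ z ⁆ (x∈⁅x⁆ z)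

    extend : Colouring n → Bool → Colouring n
    extend c b = updateAt c z (const b)

    extend-leaf : ∀ c b → extend c b z ≡ b
    extend-leaf c b = updateAt-updates z c

    extend-old : ∀ c b {x} → x ∈ U → extend c b x ≡ c x
    extend-old c b {x} x∈U = updateAt-minimal x z c (λ x≡z → z∉U (subst (_∈ U) x≡z x∈U))

    leaf-proper : ∀ {r} {R : Rel (Fin n) r} {c b v} → R ⇒ _#_ →
      (R w z → b ≢ c w) → v ∈ U → R v z → extend c b z ≢ extend c b v
    leaf-proper {c = c} {b} R⇒# b-ok v∈U vRz with refl ← w-unique v∈U (R⇒# vRz)
      rewrite extend-leaf c b | extend-old c b v∈U = b-ok vRz

    -- Every edge at the leaf goes to the stem, so only the stem's colour constrains b.
    extend-proper : ∀ {r} {R : Rel (Fin n) r} {c b} → R ⇒ _#_ → Symmetric R →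
      ProperOn R U c → (R w z → b ≢ c w) → ProperOn R U' (extend c b)
    extend-proper {c = c} {b} R⇒# R-sym c-proper b-ok x∈U' y∈U' xRy
      with x∈p∪⁅y⁆⇒x∈p⊎x≡y x∈U' | x∈p∪⁅y⁆⇒x∈p⊎x≡y y∈U'
    ... | inj₁ x∈U | inj₁ y∈U rewrite extend-old c b x∈U | extend-old c b y∈U = c-proper x∈U y∈U xRy
    ... | inj₁ x∈U | inj₂ refl = ≢-sym (leaf-proper R⇒# b-ok x∈U xRy)
    ... | inj₂ refl | inj₁ y∈U = leaf-proper R⇒# b-ok y∈U (R-sym xRy)
    ... | inj₂ refl | inj₂ refl = λ _ → #-irrefl (R⇒# xRy)

    colouring' : Colouring n
    colouring' = extend colouring (not (colouring w))

    leaf-opposite : ∀ {c} → ProperOn _#_ U' c → c z ≡ not (c w)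
    leaf-opposite c-proper = ¬-not (c-proper z∈U' (U⊆U' w∈U) (#-sym w#z))

    unique' : ∀ c → ProperOn _#_ U' c → SameOn U' colouring' c
    unique' c c-proper with unique c (ProperOn-⊆ U⊆U' c-proper)
    ... | inj₁ same = inj₁ agree
      where
      agree : ∀ {x} → x ∈ U' → c x ≡ colouring' x
      agree x∈U' with x∈p∪⁅y⁆⇒x∈p⊎x≡y x∈U'
      ... | inj₁ x∈U = trans (same x∈U) (sym (extend-old _ _ x∈U))
      ... | inj₂ refl = begin
        c z                  ≡⟨ leaf-opposite c-proper ⟩
        not (c w)            ≡⟨ cong not (same w∈U) ⟩
        not (colouring w)    ≡⟨ extend-leaf _ _ ⟨
        colouring' z         ∎
    ... | inj₂ swapped = inj₂ disagree
      where
      disagree : ∀ {x} → x ∈ U' → c x ≡ not (colouring' x)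
      disagree x∈U' with x∈p∪⁅y⁆⇒x∈p⊎x≡y x∈U'
      ... | inj₁ x∈U = trans (swapped x∈U) (cong not (sym (extend-old _ _ x∈U)))
      ... | inj₂ refl = begin
        c z                        ≡⟨ leaf-opposite c-proper ⟩
        not (c w)                  ≡⟨ cong not (swapped w∈U) ⟩
        not (not (colouring w))    ≡⟨ cong not (extend-leaf _ _) ⟨
        not (colouring' z)         ∎

    SameOn-extend⁻ : ∀ {c c' b b'} → SameOn U' (extend c b) (extend c' b') → SameOn U c c'
    SameOn-extend⁻ {c} {c'} {b} {b'} (inj₁ same) = inj₁ λ {x} x∈U → begin
      c' x                 ≡⟨ extend-old c' b' x∈U ⟨
      extend c' b' x       ≡⟨ same (U⊆U' x∈U) ⟩
      extend c b x         ≡⟨ extend-old c b x∈U ⟩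
      c x                  ∎
    SameOn-extend⁻ {c} {c'} {b} {b'} (inj₂ swapped) = inj₂ λ {x} x∈U → begin
      c' x                 ≡⟨ extend-old c' b' x∈U ⟨
      extend c' b' x       ≡⟨ swapped (U⊆U' x∈U) ⟩
      not (extend c b x)   ≡⟨ cong not (extend-old c b x∈U) ⟩
      not (c x)            ∎

    SecondColouring : ∀ {r} → Rel (Fin n) r → Set r
    SecondColouring R = ∃ λ c → ProperOn R U' c × ¬ SameOn U' colouring' c

    oldEdgeCut : ∀ {x y} → ∃ (λ c → ProperOn (withoutEdge _#_ x y) U c × ¬ SameOn U colouring c) →
      SecondColouring (withoutEdge _#_ x y)
    oldEdgeCut (c , c-proper , c-other) =
      extend c (not (c w)) ,
      extend-proper proj₁ withoutEdge-sym c-proper (λ _ → not-b≢b) ,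
      c-other ∘ SameOn-extend⁻

    -- Without the edge stem–leaf, the leaf may take the stem's colour.
    newEdgeCut : ∀ {r} {R : Rel (Fin n) r} → R ⇒ _#_ → Symmetric R → ¬ R w z → SecondColouring R
    newEdgeCut R⇒# R-sym ¬wRz =
      c ,
      extend-proper R⇒# R-sym (ProperOn-⇒ R⇒# proper) (λ wRz → contradiction wRz ¬wRz) ,
      differs
      where
      c : Colouring n
      c = extend colouring (colouring w)
      differs : ¬ SameOn U' colouring' c
      differs (inj₁ same) = not-b≢b (begin
        not (colouring w)    ≡⟨ extend-leaf _ _ ⟨
        colouring' z         ≡⟨ same z∈U' ⟨
        c z                  ≡⟨ extend-leaf _ _ ⟩
        colouring w          ∎)
      differs (inj₂ swapped) = not-b≢b (begin
        not (colouring w)    ≡⟨ cong not (extend-old _ _ w∈U) ⟨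
        not (colouring' w)   ≡⟨ swapped (U⊆U' w∈U) ⟨
        c w                  ≡⟨ extend-old _ _ w∈U ⟩
        colouring w          ∎)

    bridge' : ∀ {x y} → x ∈ U' → y ∈ U' → x # y → SecondColouring (withoutEdge _#_ x y)
    bridge' x∈U' y∈U' x#y with x∈p∪⁅y⁆⇒x∈p⊎x≡y x∈U' | x∈p∪⁅y⁆⇒x∈p⊎x≡y y∈U'
    ... | inj₁ x∈U | inj₁ y∈U = oldEdgeCut (bridge x∈U y∈U x#y)
    ... | inj₁ x∈U | inj₂ refl with refl ← w-unique x∈U x#y =
      newEdgeCut proj₁ withoutEdge-sym (λ (_ , ¬wz , _) → ¬wz (refl , refl))
    ... | inj₂ refl | inj₁ y∈U with refl ← w-unique y∈U (#-sym x#y) =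
      newEdgeCut proj₁ withoutEdge-sym (λ (_ , _ , ¬wz) → ¬wz (refl , refl))
    ... | inj₂ refl | inj₂ refl = contradiction x#y #-irrefl

    tree : Tree _#_ U'
    tree = record
      { colouring = colouring'
      ; proper = extend-proper (λ x#y → x#y) #-sym proper (λ _ → not-b≢b)
      ; unique = unique'
      ; bridge = bridge'
      }

  Tree-extend : ∀ {U U'} → Tree _#_ U → LeafExtension _#_ U U' → Tree _#_ U'
  Tree-extend T E = subst (Tree _#_) (sym U'≡U∪leaf) (AddLeaf.tree T leaf∉U stem∈U stem#leaf stem-unique)
    where open LeafExtension E

Incomparable : ∀ {n} → FinPoset n → Rel (Fin n) 0ℓ
Incomparable P x y = ¬ _≼_ P x y × ¬ _≼_ P y x

module _ {n : ℕ} (P : FinPoset n) where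

  Incomparable-sym : Symmetric (Incomparable P)
  Incomparable-sym (x⋠y , y⋠x) = y⋠x , x⋠y

  Incomparable-irrefl : ∀ {x} → ¬ Incomparable P x x
  Incomparable-irrefl (x⋠x , _) = x⋠x (IsPartialOrder.refl (isPartialOrder P))

  ProperOn⊤⇒IsTwoChainCover : ∀ {c} → ProperOn (Incomparable P) ⊤ c → IsTwoChainCover P c
  ProperOn⊤⇒IsTwoChainCover proper x y cx≡cy with _≼?_ P x y | _≼?_ P y x
  ... | yes x≼y | _ = inj₁ x≼y
  ... | no _ | yes y≼x = inj₂ y≼x
  ... | no x⋠y | no y⋠x = contradiction cx≡cy (proper ∈⊤ ∈⊤ (x⋠y , y⋠x))

  IsTwoChainCover⇒ProperOn : ∀ {U c} → IsTwoChainCover P c → ProperOn (Incomparable P) U c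
  IsTwoChainCover⇒ProperOn cover {x} {y} _ _ (x⋠y , y⋠x) cx≡cy = [ x⋠y , y⋠x ]′ (cover x y cx≡cy)

module _ {n : ℕ} (P : FinPoset n) where

  private
    infix 4 _⊑_ _⊏_
    _⊑_ : Rel (Fin n) 0ℓ
    _⊑_ = _≼_ P
    _⊏_ : Rel (Fin n) 0ℓ
    _⊏_ = ToStrict._<_ _≡_ _⊑_
    _⊏?_ : Decidable _⊏_
    _⊏?_ = ToStrict.<-decidable _≡_ _⊑_ _≟_ (_≼?_ P)
    module ⊑ = IsPartialOrder (isPartialOrder P)

  open TreeGrowth {_#_ = Incomparable P} (Incomparable-sym P) (Incomparable-irrefl P)

  module _ {Q : FinPoset n} {x y : Fin n} (P⊆Q : ∀ u v → u ⊑ v → _≼_ Q u v) (x≼y : _≼_ Q x y) where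

    refinement-incomparable : Incomparable Q ⇒ withoutEdge (Incomparable P) x y
    refinement-incomparable (u⋠v , v⋠u) =
      (u⋠v ∘ P⊆Q _ _ , v⋠u ∘ P⊆Q _ _) , (λ { (refl , refl) → u⋠v x≼y }) , (λ { (refl , refl) → v⋠u x≼y })

    refinement-newly-comparable : ¬ x ⊑ y → Incomparable P x y
    refinement-newly-comparable x⋢y =
      x⋢y , λ y⊑x → x⋢y (subst (x ⊑_) (IsPartialOrder.antisym (isPartialOrder Q) x≼y (P⊆Q y x y⊑x)) ⊑.refl)

  Tree⊤⇒IsTwoChain : Tree (Incomparable P) ⊤ → IsTwoChain P
  Tree⊤⇒IsTwoChain T = (colouring , ProperOn⊤⇒IsTwoChainCover P proper , uniqueCover) , severalCovers
    where
    open Tree T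
    uniqueCover : ∀ c → IsTwoChainCover P c → SameCover colouring c
    uniqueCover c cover = SameOn-⊤⇒SameCover (unique c (IsTwoChainCover⇒ProperOn P cover))
    severalCovers : ∀ Q → IsProperRefinement P Q → SeveralTwoChainCovers Q
    severalCovers Q (P⊆Q , x , y , x≼y , x⋢y) =
      let (c , c-proper , c-other) = bridge ∈⊤ ∈⊤ (refinement-newly-comparable {Q} P⊆Q x≼y x⋢y)
          Q⇒P∖xy = refinement-incomparable {Q} P⊆Q x≼y
      in colouring , c ,
         ProperOn⊤⇒IsTwoChainCover Q (ProperOn-⇒ (proj₁ ∘ Q⇒P∖xy) proper) ,
         ProperOn⊤⇒IsTwoChainCover Q (ProperOn-⇒ Q⇒P∖xy c-proper) ,
         c-other ∘ SameCover⇒SameOn-⊤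

  DownClosed : Subset n → Set
  DownClosed I = ∀ {x y} → x ⊑ y → y ∈ I → x ∈ I

  IsIdeal⇒DownClosed : ∀ {I} → IsIdeal P I → DownClosed I
  IsIdeal⇒DownClosed {I} ideal {x} {y} x⊑y y∈I =
    decidable-stable (x ∈? I) λ x∉I → ideal x y y∈I x∉I x⊑y

  DownClosed⇒IsIdeal : ∀ {I} → DownClosed I → IsIdeal P I
  DownClosed⇒IsIdeal closed x y y∈I x∉I x⊑y = x∉I (closed x⊑y y∈I)

  IsIdeal-∪ : ∀ {I J} → IsIdeal P I → IsIdeal P J → IsIdeal P (I ∪ J)
  IsIdeal-∪ {I} {J} I-ideal J-ideal = DownClosed⇒IsIdeal λ x⊑y y∈I∪J →
    [ p⊆p∪q J ∘ IsIdeal⇒DownClosed I-ideal x⊑y , q⊆p∪q I J ∘ IsIdeal⇒DownClosed J-ideal x⊑y ]′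
      (x∈p∪q⁻ I J y∈I∪J)

  ↓_ : Fin n → Subset n
  ↓ x = subsetOf (λ u → _≼?_ P u x)

  ∈↓⁺ : ∀ {u x} → u ⊑ x → u ∈ ↓ x
  ∈↓⁺ {x = x} = ∈subsetOf⁺ {A = _⊑ x} (λ u → _≼?_ P u x)

  ∈↓⁻ : ∀ {u x} → u ∈ ↓ x → u ⊑ x
  ∈↓⁻ {x = x} = ∈subsetOf⁻ {A = _⊑ x} (λ u → _≼?_ P u x)

  ↓-isIdeal : ∀ x → IsIdeal P (↓ x)
  ↓-isIdeal x = DownClosed⇒IsIdeal λ u⊑v v∈↓x → ∈↓⁺ (⊑.trans u⊑v (∈↓⁻ v∈↓x))

  ↓x-x-isIdeal : ∀ x → IsIdeal P (↓ x - x)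
  ↓x-x-isIdeal x = DownClosed⇒IsIdeal λ {u} {v} u⊑v v∈↓x-x →
    let v⊑x = ∈↓⁻ (p─q⊆p (↓ x) ⁅ x ⁆ v∈↓x-x)
        v≢x = x∉⁅y⁆⇒x≢y (x∈p─q⇒x∉q v∈↓x-x)
    in x∈p∧x≢y⇒x∈p-y (∈↓⁺ (⊑.trans u⊑v v⊑x)) λ { refl → v≢x (⊑.antisym v⊑x u⊑v) }

  sideIdeal : Fin n → Fin n → Subset n
  sideIdeal w z = ↓ w ∪ (↓ z - z)

  sideIdeal-isIdeal : ∀ w z → IsIdeal P (sideIdeal w z)
  sideIdeal-isIdeal w z = IsIdeal-∪ (↓-isIdeal w) (↓x-x-isIdeal z)

  w∈sideIdeal : ∀ w z → w ∈ sideIdeal w z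
  w∈sideIdeal w z = p⊆p∪q (↓ z - z) (∈↓⁺ ⊑.refl)

  z∉sideIdeal : ∀ {w z} → ¬ z ⊑ w → z ∉ sideIdeal w z
  z∉sideIdeal {w} {z} z⋢w z∈ with x∈p∪q⁻ (↓ w) (↓ z - z) z∈
  ... | inj₁ z∈↓w = z⋢w (∈↓⁻ z∈↓w)
  ... | inj₂ z∈↓z-z = x∉p-x (↓ z) z z∈↓z-z

  sideIdeal-below : ∀ {w z v} → v ∈ sideIdeal w z → ¬ v ⊑ z → v ⊑ w
  sideIdeal-below {w} {z} v∈ v⋢z with x∈p∪q⁻ (↓ w) (↓ z - z) v∈
  ... | inj₁ v∈↓w = ∈↓⁻ v∈↓w
  ... | inj₂ v∈↓z-z = contradiction (∈↓⁻ (p─q⊆p (↓ z) ⁅ z ⁆ v∈↓z-z)) v⋢z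

  ∣sideIdeal∣≡1+∣↓w-w∪↓z-z∣ : ∀ {w z} → ¬ w ⊑ z → ∣ sideIdeal w z ∣ ≡ suc ∣ (↓ w - w) ∪ (↓ z - z) ∣
  ∣sideIdeal∣≡1+∣↓w-w∪↓z-z∣ {w} {z} w⋢z = trans (cong ∣_∣ regroup) (x∉p⇒∣p∪⁅x⁆∣≡1+∣p∣ w∉)
    where
    open ≡-Reasoning
    regroup : sideIdeal w z ≡ ((↓ w - w) ∪ (↓ z - z)) ∪ ⁅ w ⁆
    regroup = begin
      ↓ w ∪ (↓ z - z)                    ≡⟨ cong (_∪ (↓ z - z)) (x∈p⇒p≡p-x∪⁅x⁆ (∈↓⁺ ⊑.refl)) ⟩
      ((↓ w - w) ∪ ⁅ w ⁆) ∪ (↓ z - z)    ≡⟨ ∪-assoc (↓ w - w) ⁅ w ⁆ (↓ z - z) ⟩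
      (↓ w - w) ∪ (⁅ w ⁆ ∪ (↓ z - z))    ≡⟨ cong ((↓ w - w) ∪_) (∪-comm ⁅ w ⁆ (↓ z - z)) ⟩
      (↓ w - w) ∪ ((↓ z - z) ∪ ⁅ w ⁆)    ≡⟨ ∪-assoc (↓ w - w) (↓ z - z) ⁅ w ⁆ ⟨
      ((↓ w - w) ∪ (↓ z - z)) ∪ ⁅ w ⁆    ∎
    w∉ : w ∉ (↓ w - w) ∪ (↓ z - z)
    w∉ w∈ with x∈p∪q⁻ (↓ w - w) (↓ z - z) w∈
    ... | inj₁ w∈↓w-w = x∉p-x (↓ w) w w∈↓w-w
    ... | inj₂ w∈↓z-z = w⋢z (∈↓⁻ (p─q⊆p (↓ z) ⁅ z ⁆ w∈↓z-z))

  ∣sideIdeal∣-comm : ∀ {w z} → Incomparable P w z → ∣ sideIdeal w z ∣ ≡ ∣ sideIdeal z w ∣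
  ∣sideIdeal∣-comm {w} {z} (w⋢z , z⋢w) = begin
    ∣ sideIdeal w z ∣                     ≡⟨ ∣sideIdeal∣≡1+∣↓w-w∪↓z-z∣ w⋢z ⟩
    suc ∣ (↓ w - w) ∪ (↓ z - z) ∣         ≡⟨ cong (suc ∘ ∣_∣) (∪-comm (↓ w - w) (↓ z - z)) ⟩
    suc ∣ (↓ z - z) ∪ (↓ w - w) ∣         ≡⟨ ∣sideIdeal∣≡1+∣↓w-w∪↓z-z∣ z⋢w ⟨
    ∣ sideIdeal z w ∣                     ∎
    where open ≡-Reasoning

  module Exchange {A B : Subset n} (A-ideal : IsIdeal P A) (B-ideal : IsIdeal P B)
    {a b : Fin n} (a∈A : a ∈ A) (a∉B : a ∉ B) (a-minimal : ∀ {x} → x ∈ A × x ∉ B → ¬ x ⊏ a)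
    (b∈B : b ∈ B) (b∉A : b ∉ A) (b-maximal : ∀ {x} → x ∈ B × x ∉ A → ¬ b ⊏ x) where

    B-b-isIdeal : IsIdeal P (B - b)
    B-b-isIdeal = DownClosed⇒IsIdeal λ {x} {y} x⊑y y∈B-b →
      let y∈B = p─q⊆p B ⁅ b ⁆ y∈B-b
          y≢b = x∉⁅y⁆⇒x≢y (x∈p─q⇒x∉q y∈B-b)
      in x∈p∧x≢y⇒x∈p-y (IsIdeal⇒DownClosed B-ideal x⊑y y∈B) λ { refl →
           b-maximal (y∈B , λ y∈A → b∉A (IsIdeal⇒DownClosed A-ideal x⊑y y∈A)) (x⊑y , ≢-sym y≢b) }

    exchange-isIdeal : IsIdeal P ((B - b) ∪ ⁅ a ⁆)
    exchange-isIdeal = DownClosed⇒IsIdeal closed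
      where
      closed : DownClosed ((B - b) ∪ ⁅ a ⁆)
      closed x⊑y y∈ with x∈p∪⁅y⁆⇒x∈p⊎x≡y y∈
      ... | inj₁ y∈B-b = p⊆p∪q ⁅ a ⁆ (IsIdeal⇒DownClosed B-b-isIdeal x⊑y y∈B-b)
      ... | inj₂ refl = belowMinimal x⊑y
        where
        belowMinimal : ∀ {x} → x ⊑ a → x ∈ (B - b) ∪ ⁅ a ⁆
        belowMinimal {x} x⊑a with x ≟ a | x ∈? B
        ... | yes refl | _ = q⊆p∪q (B - b) ⁅ a ⁆ (x∈⁅x⁆ a)
        ... | no x≢a | yes x∈B = p⊆p∪q ⁅ a ⁆ (x∈p∧x≢y⇒x∈p-y x∈B λ { refl → b∉A x∈A })
          where x∈A = IsIdeal⇒DownClosed A-ideal x⊑a a∈A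
        ... | no x≢a | no x∉B = contradiction (x⊑a , x≢a)
                                  (a-minimal (IsIdeal⇒DownClosed A-ideal x⊑a a∈A , x∉B))

    ∣exchange∣≡∣B∣ : ∣ (B - b) ∪ ⁅ a ⁆ ∣ ≡ ∣ B ∣
    ∣exchange∣≡∣B∣ = trans (x∉p⇒∣p∪⁅x⁆∣≡1+∣p∣ (a∉B ∘ p─q⊆p B ⁅ b ⁆)) (sym (x∈p⇒∣p∣≡1+∣p-x∣ b∈B))

    exchange≡A⇒A∪B≡B∪⁅a⁆ : (B - b) ∪ ⁅ a ⁆ ≡ A → A ∪ B ≡ B ∪ ⁅ a ⁆
    exchange≡A⇒A∪B≡B∪⁅a⁆ exchange≡A =
      ⊆-antisym A∪B⊆ (p⊆q∧y∈q⇒p∪⁅y⁆⊆q (q⊆p∪q A B) (p⊆p∪q B a∈A))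
      where
      A∪B⊆ : A ∪ B ⊆ B ∪ ⁅ a ⁆
      A∪B⊆ x∈A∪B with x∈p∪q⁻ A B x∈A∪B
      ... | inj₂ x∈B = p⊆p∪q ⁅ a ⁆ x∈B
      ... | inj₁ x∈A with x∈p∪⁅y⁆⇒x∈p⊎x≡y (subst (_ ∈_) (sym exchange≡A) x∈A)
      ...   | inj₁ x∈B-b = p⊆p∪q ⁅ a ⁆ (p─q⊆p B ⁅ b ⁆ x∈B-b)
      ...   | inj₂ refl = q⊆p∪q B ⁅ a ⁆ (x∈⁅x⁆ a)

  onlyTwo : ∀ {m} → ExactlyTwoIdealsOfSize P m → ∀ {X Y Z} → X ≢ Y →
    IsIdealOfSize P m X → IsIdealOfSize P m Y → IsIdealOfSize P m Z → Z ≡ X ⊎ Z ≡ Y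
  onlyTwo (_ , _ , _ , _ , _ , only) X≢Y X-ideal Y-ideal Z-ideal
    with only _ X-ideal | only _ Y-ideal | only _ Z-ideal
  ... | inj₁ refl | inj₁ refl | _ = contradiction refl X≢Y
  ... | inj₂ refl | inj₂ refl | _ = contradiction refl X≢Y
  ... | inj₁ refl | inj₂ refl | inj₁ refl = inj₁ refl
  ... | inj₁ refl | inj₂ refl | inj₂ refl = inj₂ refl
  ... | inj₂ refl | inj₁ refl | inj₁ refl = inj₂ refl
  ... | inj₂ refl | inj₁ refl | inj₂ refl = inj₁ refl

  anotherIdeal : ∀ {m} → ExactlyTwoIdealsOfSize P m → ∀ {V} → IsIdealOfSize P m V →
    ∃ λ O → IsIdealOfSize P m O × O ≢ V
  anotherIdeal (Q₁ , Q₂ , Q₁≢Q₂ , Q₁-ideal , Q₂-ideal , only) V-ideal with only _ V-ideal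
  ... | inj₁ refl = Q₂ , Q₂-ideal , Q₁≢Q₂ ∘ sym
  ... | inj₂ refl = Q₁ , Q₁-ideal , Q₁≢Q₂

  union : ∀ {m} → ExactlyTwoIdealsOfSize P m → Subset n
  union (Q₁ , Q₂ , _) = Q₁ ∪ Q₂

  union-isIdeal : ∀ {m} (E : ExactlyTwoIdealsOfSize P m) → IsIdeal P (union E)
  union-isIdeal (_ , _ , _ , (Q₁-ideal , _) , (Q₂-ideal , _) , _) = IsIdeal-∪ Q₁-ideal Q₂-ideal

  ⊆union : ∀ {m} (E : ExactlyTwoIdealsOfSize P m) → ∀ {I} → IsIdealOfSize P m I → I ⊆ union E
  ⊆union (Q₁ , Q₂ , _ , _ , _ , only) I-ideal with only _ I-ideal
  ... | inj₁ refl = p⊆p∪q Q₂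
  ... | inj₂ refl = q⊆p∪q Q₁ Q₂

  ∣union∣≡1+m : ∀ {m} (E : ExactlyTwoIdealsOfSize P m) → ∣ union E ∣ ≡ suc m
  ∣union∣≡1+m {m} (A , B , A≢B , (A-ideal , ∣A∣≡m) , (B-ideal , ∣B∣≡m) , only)
    with ∣p∣≡∣q∣∧p≢q⇒∃x∈p∖q (trans ∣A∣≡m (sym ∣B∣≡m)) A≢B
       | ∣p∣≡∣q∣∧p≢q⇒∃x∈p∖q (trans ∣B∣≡m (sym ∣A∣≡m)) (A≢B ∘ sym)
  ... | a₀ , a₀∈A∖B | b₀ , b₀∈B∖A
    with minimal (po-wellFounded (isPartialOrder P)) _⊏?_ (λ x → x ∈? A ×-dec ¬? (x ∈? B)) a₀∈A∖B
       | minimal (po-noetherian (isPartialOrder P)) (flip _⊏?_) (λ x → x ∈? B ×-dec ¬? (x ∈? A)) b₀∈B∖A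
  ... | a , (a∈A , a∉B) , a-minimal | b , (b∈B , b∉A) , b-maximal = begin
    ∣ A ∪ B ∣       ≡⟨ cong ∣_∣ (exchange≡A⇒A∪B≡B∪⁅a⁆ exchange≡A) ⟩
    ∣ B ∪ ⁅ a ⁆ ∣   ≡⟨ x∉p⇒∣p∪⁅x⁆∣≡1+∣p∣ a∉B ⟩
    suc ∣ B ∣       ≡⟨ cong suc ∣B∣≡m ⟩
    suc m           ∎
    where
    open ≡-Reasoning
    open Exchange A-ideal B-ideal a∈A a∉B a-minimal b∈B b∉A b-maximal
    exchange≡A : (B - b) ∪ ⁅ a ⁆ ≡ A
    exchange≡A with only _ (exchange-isIdeal , trans ∣exchange∣≡∣B∣ ∣B∣≡m)
    ... | inj₁ exchange≡A = exchange≡A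
    ... | inj₂ exchange≡B = contradiction (subst (a ∈_) exchange≡B (q⊆p∪q (B - b) ⁅ a ⁆ (x∈⁅x⁆ a))) a∉B

  singletonLeaf : (E : ExactlyTwoIdealsOfSize P 1) → ∃ λ a → LeafExtension (Incomparable P) ⁅ a ⁆ (union E)
  singletonLeaf E@(A , B , A≢B , (A-ideal , ∣A∣≡1) , (B-ideal , ∣B∣≡1) , _)
    with ∣p∣≡∣q∣∧p≢q⇒∃x∈p∖q (trans ∣A∣≡1 (sym ∣B∣≡1)) A≢B
       | ∣p∣≡∣q∣∧p≢q⇒∃x∈p∖q (trans ∣B∣≡1 (sym ∣A∣≡1)) (A≢B ∘ sym)
  ... | a , a∈A , a∉B | b , b∈B , b∉A = a , record
    { leaf = b
    ; stem = a
    ; leaf∉U = b∉⁅a⁆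
    ; U'≡U∪leaf = sym (p⊆q∧∣q∣≤∣p∣⇒p≡q a∪b⊆A∪B (≤-reflexive ∣A∪B∣≡∣a∪b∣))
    ; stem∈U = x∈⁅x⁆ a
    ; stem#leaf = (λ a⊑b → a∉B (IsIdeal⇒DownClosed B-ideal a⊑b b∈B))
                , (λ b⊑a → b∉A (IsIdeal⇒DownClosed A-ideal b⊑a a∈A))
    ; stem-unique = λ v∈⁅a⁆ _ → x∈⁅y⁆⇒x≡y a v∈⁅a⁆
    }
    where
    b∉⁅a⁆ : b ∉ ⁅ a ⁆
    b∉⁅a⁆ b∈⁅a⁆ = b∉A (subst (_∈ A) (sym (x∈⁅y⁆⇒x≡y a b∈⁅a⁆)) a∈A)
    a∪b⊆A∪B : ⁅ a ⁆ ∪ ⁅ b ⁆ ⊆ A ∪ B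
    a∪b⊆A∪B = p⊆q∧y∈q⇒p∪⁅y⁆⊆q (λ x∈⁅a⁆ → subst (_∈ A ∪ B) (sym (x∈⁅y⁆⇒x≡y a x∈⁅a⁆)) (p⊆p∪q B a∈A))
                               (q⊆p∪q A B b∈B)
    ∣A∪B∣≡∣a∪b∣ : ∣ A ∪ B ∣ ≡ ∣ ⁅ a ⁆ ∪ ⁅ b ⁆ ∣
    ∣A∪B∣≡∣a∪b∣ = trans (∣union∣≡1+m E) (sym (trans (x∉p⇒∣p∪⁅x⁆∣≡1+∣p∣ b∉⁅a⁆) (cong suc (∣⁅x⁆∣≡1 a))))

  module Levels (two : ∀ m → 1 ≤ m → m < n → ExactlyTwoIdealsOfSize P m) where

    -- The bounds are irrelevant, so U m does not depend on how they are proved.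
    level : (m : ℕ) .(1≤m : 1 ≤ m) .(m<n : m < n) → ExactlyTwoIdealsOfSize P m
    level m 1≤m m<n = two m (recompute (1 ≤? m) 1≤m) (recompute (m <? n) m<n)

    U : (m : ℕ) .(1≤m : 1 ≤ m) .(m<n : m < n) → Subset n
    U m 1≤m m<n = union (level m 1≤m m<n)

    U-isIdealOfSize : (m : ℕ) .(1≤m : 1 ≤ m) .(m<n : m < n) → IsIdealOfSize P (suc m) (U m 1≤m m<n)
    U-isIdealOfSize m 1≤m m<n = union-isIdeal (level m 1≤m m<n) , ∣union∣≡1+m (level m 1≤m m<n)

    U-step : ∀ {m} .(1≤m : 1 ≤ m) (m+1<n : suc m < n) →
      U m 1≤m (<-trans (n<1+n m) m+1<n) ⊆ U (suc m) (s≤s z≤n) m+1<n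
    U-step {m} 1≤m m+1<n =
      ⊆union (level (suc m) (s≤s z≤n) m+1<n) (U-isIdealOfSize m 1≤m (<-trans (n<1+n m) m+1<n))

    U-mono : ∀ {s t} (1≤s : 1 ≤ s) .(s<n : s < n) .(1≤t : 1 ≤ t) (t<n : t < n) →
      s ≤′ t → U s 1≤s s<n ⊆ U t 1≤t t<n
    U-mono _ _ _ _ ≤′-refl = ⊆-refl
    U-mono {s} {suc t} 1≤s s<n _ t+1<n (≤′-step s≤′t) =
      ⊆-trans (U-mono 1≤s s<n 1≤t (<-trans (n<1+n t) t+1<n) s≤′t) (U-step 1≤t t+1<n)
      where
      1≤t : 1 ≤ t
      1≤t = ≤-trans 1≤s (≤′⇒≤ s≤′t)

    sideIdeals-only : ∀ {w z V} → Incomparable P w z → IsIdealOfSize P ∣ sideIdeal w z ∣ V →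
      V ≡ sideIdeal w z ⊎ V ≡ sideIdeal z w
    sideIdeals-only {w} {z} w∥z@(w⋢z , z⋢w) V-ideal =
      onlyTwo (level ∣ sideIdeal w z ∣ (x∈p⇒0<∣p∣ (w∈sideIdeal w z)) (x∉p⇒∣p∣<n (z∉sideIdeal z⋢w)))
        (λ X≡Y → z∉sideIdeal w⋢z (subst (w ∈_) X≡Y (w∈sideIdeal w z)))
        (sideIdeal-isIdeal w z , refl) (sideIdeal-isIdeal z w , sym (∣sideIdeal∣-comm w∥z)) V-ideal

    module Step {m : ℕ} (1≤m : 1 ≤ m) (m+1<n : suc m < n) where

      m<n : m < n
      m<n = <-trans (n<1+n m) m+1<n

      Uₘ : Subset n
      Uₘ = U m 1≤m m<n

      Uₘ₊₁ : Subset n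
      Uₘ₊₁ = U (suc m) (s≤s z≤n) m+1<n

      -- If all of Uₘ lay below z, the second ideal of size m + 1 would be squeezed
      -- between Uₘ and Uₘ ∪ {z}.
      Uₘ⊈↓z : ∀ {z} → z ∉ Uₘ → Uₘ₊₁ ≡ Uₘ ∪ ⁅ z ⁆ → Uₘ ⊈ ↓ z
      Uₘ⊈↓z {z} z∉Uₘ Uₘ₊₁≡ Uₘ⊆↓z =
        noOther (anotherIdeal (level (suc m) (s≤s z≤n) m+1<n) (U-isIdealOfSize m 1≤m m<n))
        where
        noOther : ¬ (∃ λ O → IsIdealOfSize P (suc m) O × O ≢ Uₘ)
        noOther (O , O-ideal@(O-isIdeal , ∣O∣≡1+m) , O≢Uₘ) = O≢Uₘ (byLeaf (z ∈? O))
          where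
          ∣Uₘ∣≡∣O∣ : ∣ Uₘ ∣ ≡ ∣ O ∣
          ∣Uₘ∣≡∣O∣ = trans (∣union∣≡1+m (level m 1≤m m<n)) (sym ∣O∣≡1+m)
          byLeaf : Dec (z ∈ O) → O ≡ Uₘ
          byLeaf (yes z∈O) = contradiction (p⊂q⇒∣p∣<∣q∣ (Uₘ⊆O , z , z∈O , z∉Uₘ)) (<-irrefl ∣Uₘ∣≡∣O∣)
            where
            Uₘ⊆O : Uₘ ⊆ O
            Uₘ⊆O u∈Uₘ = IsIdeal⇒DownClosed O-isIdeal (∈↓⁻ (Uₘ⊆↓z u∈Uₘ)) z∈O
          byLeaf (no z∉O) = p⊆q∧∣q∣≤∣p∣⇒p≡q O⊆Uₘ (≤-reflexive ∣Uₘ∣≡∣O∣)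
            where
            O⊆Uₘ : O ⊆ Uₘ
            O⊆Uₘ x∈O = [ (λ x∈Uₘ → x∈Uₘ) , (λ { refl → contradiction x∈O z∉O }) ]′
              (x∈p∪⁅y⁆⇒x∈p⊎x≡y (subst (_ ∈_) Uₘ₊₁≡ (⊆union (level (suc m) (s≤s z≤n) m+1<n) O-ideal x∈O)))

      stem-exists : ∀ {z} → z ∉ Uₘ → Uₘ₊₁ ≡ Uₘ ∪ ⁅ z ⁆ → ∃ λ w → w ∈ Uₘ × Incomparable P w z
      stem-exists {z} z∉Uₘ Uₘ₊₁≡ with any? (λ w → w ∈? Uₘ ×-dec (¬? (_≼?_ P w z) ×-dec ¬? (_≼?_ P z w)))
      ... | yes stem = stem
      ... | no none = ⊥-elim (Uₘ⊈↓z z∉Uₘ Uₘ₊₁≡ λ {u} u∈Uₘ → ∈↓⁺ (decidable-stable (_≼?_ P u z) λ u⋢z →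
            none (u , u∈Uₘ , u⋢z , λ z⊑u → z∉Uₘ (IsIdeal⇒DownClosed (proj₁ (U-isIdealOfSize m 1≤m m<n)) z⊑u u∈Uₘ))))

      -- Every ideal of size ∣ sideIdeal w z ∣ = 1 + j is one of the two side ideals,
      -- each of which misses w or z.  If j < m then U₁₊ⱼ ⊆ Uₘ would contain z, and
      -- if j > m then Uⱼ would contain both w and z; so j = m.
      Uₘ≡sideIdeal : ∀ {w z} → w ∈ Uₘ → z ∈ Uₘ₊₁ → z ∉ Uₘ → Incomparable P w z → Uₘ ≡ sideIdeal w z
      Uₘ≡sideIdeal {w} {z} w∈Uₘ z∈Uₘ₊₁ z∉Uₘ w∥z@(w⋢z , z⋢w) = compare (<-cmp j m)
        where
        j : ℕ
        j = ∣ (↓ w - w) ∪ (↓ z - z) ∣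
        ∣X∣≡1+j : ∣ sideIdeal w z ∣ ≡ suc j
        ∣X∣≡1+j = ∣sideIdeal∣≡1+∣↓w-w∪↓z-z∣ w⋢z
        j<n : j < n
        j<n = <-trans (n<1+n j) (subst (_< n) ∣X∣≡1+j (x∉p⇒∣p∣<n (z∉sideIdeal z⋢w)))
        z∈Y : z ∈ sideIdeal z w
        z∈Y = w∈sideIdeal z w
        w∉Y : w ∉ sideIdeal z w
        w∉Y = z∉sideIdeal w⋢z
        compare : Tri (j < m) (j ≡ m) (m < j) → Uₘ ≡ sideIdeal w z
        compare (tri< j<m _ _) = contradiction (U-mono (s≤s z≤n) j+1<n 1≤m m<n (≤⇒≤′ j<m) z∈Uⱼ₊₁) z∉Uₘ
          where
          j+1<n = ≤-<-trans j<m m<n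
          z∈Uⱼ₊₁ = ⊆union (level (suc j) (s≤s z≤n) j+1<n)
                     (sideIdeal-isIdeal z w , trans (sym (∣sideIdeal∣-comm w∥z)) ∣X∣≡1+j) z∈Y
        compare (tri≈ _ j≡m _) =
          [ (λ Uₘ≡X → Uₘ≡X) , (λ Uₘ≡Y → contradiction (subst (z ∈_) (sym Uₘ≡Y) z∈Y) z∉Uₘ) ]′
            (sideIdeals-only w∥z (proj₁ (U-isIdealOfSize m 1≤m m<n) ,
               trans (∣union∣≡1+m (level m 1≤m m<n)) (sym (trans ∣X∣≡1+j (cong suc j≡m)))))
        compare (tri> _ _ m<j) =
          [ (λ Uⱼ≡X → contradiction (subst (z ∈_) Uⱼ≡X z∈Uⱼ) (z∉sideIdeal z⋢w))
          , (λ Uⱼ≡Y → contradiction (subst (w ∈_) Uⱼ≡Y w∈Uⱼ) w∉Y)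
          ]′ (sideIdeals-only w∥z (proj₁ (U-isIdealOfSize j 1≤j j<n) ,
                trans (∣union∣≡1+m (level j 1≤j j<n)) (sym ∣X∣≡1+j)))
          where
          1≤j = ≤-trans 1≤m (<⇒≤ m<j)
          z∈Uⱼ = U-mono (s≤s z≤n) m+1<n 1≤j j<n (≤⇒≤′ m<j) z∈Uₘ₊₁
          w∈Uⱼ = U-mono 1≤m m<n 1≤j j<n (≤⇒≤′ (<⇒≤ m<j)) w∈Uₘ

      leafExtension : LeafExtension (Incomparable P) Uₘ Uₘ₊₁
      leafExtension = withLeaf (p⊆q∧∣q∣≡1+∣p∣⇒q≡p∪⁅x⁆ (U-step 1≤m m+1<n) ∣Uₘ₊₁∣≡1+∣Uₘ∣)
        where
        ∣Uₘ₊₁∣≡1+∣Uₘ∣ : ∣ Uₘ₊₁ ∣ ≡ suc ∣ Uₘ ∣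
        ∣Uₘ₊₁∣≡1+∣Uₘ∣ = trans (∣union∣≡1+m (level (suc m) (s≤s z≤n) m+1<n))
                              (cong suc (sym (∣union∣≡1+m (level m 1≤m m<n))))
        withLeaf : (∃ λ z → z ∉ Uₘ × Uₘ₊₁ ≡ Uₘ ∪ ⁅ z ⁆) → LeafExtension (Incomparable P) Uₘ Uₘ₊₁
        withLeaf (z , z∉Uₘ , Uₘ₊₁≡) = withStem (stem-exists z∉Uₘ Uₘ₊₁≡)
          where
          z∈Uₘ₊₁ : z ∈ Uₘ₊₁
          z∈Uₘ₊₁ = subst (z ∈_) (sym Uₘ₊₁≡) (q⊆p∪q Uₘ ⁅ z ⁆ (x∈⁅x⁆ z))
          below : ∀ {v w} → v ∈ Uₘ → Incomparable P v z → w ∈ Uₘ → Incomparable P w z → v ⊑ w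
          below v∈Uₘ (v⋢z , _) w∈Uₘ w∥z =
            sideIdeal-below (subst (_ ∈_) (Uₘ≡sideIdeal w∈Uₘ z∈Uₘ₊₁ z∉Uₘ w∥z) v∈Uₘ) v⋢z
          withStem : (∃ λ w → w ∈ Uₘ × Incomparable P w z) → LeafExtension (Incomparable P) Uₘ Uₘ₊₁
          withStem (w , w∈Uₘ , w∥z) = record
            { leaf = z
            ; stem = w
            ; leaf∉U = z∉Uₘ
            ; U'≡U∪leaf = Uₘ₊₁≡
            ; stem∈U = w∈Uₘ
            ; stem#leaf = w∥z
            ; stem-unique = λ v∈Uₘ v∥z → ⊑.antisym (below v∈Uₘ v∥z w∈Uₘ w∥z) (below w∈Uₘ w∥z v∈Uₘ v∥z)
            }

    levelTree : ∀ m (1≤m : 1 ≤ m) (m<n : m < n) → Tree (Incomparable P) (U m 1≤m m<n)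
    levelTree (suc zero) _ 1<n =
      let a , extension = singletonLeaf (level 1 (s≤s z≤n) 1<n)
      in Tree-extend (Tree-⁅⁆ a) extension
    levelTree (suc (suc m)) _ m+2<n =
      Tree-extend (levelTree (suc m) (s≤s z≤n) (<-trans (n<1+n _) m+2<n))
                  (Step.leafExtension (s≤s z≤n) m+2<n)

proposition3p8 : (n : ℕ) (P : FinPoset n) →
    (∀ m → 1 ≤ m → m < n → ExactlyTwoIdealsOfSize P m) →
    IsTwoChain P
-- On Fin 0 and Fin 1 the full subset ⊤ is definitionally ⊥ and ⁅ zero ⁆.
proposition3p8 zero P _ = Tree⊤⇒IsTwoChain P (Tree-⊥ (Incomparable P))
proposition3p8 (suc zero) P _ = Tree⊤⇒IsTwoChain P (Tree-⁅⁆ zero)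
  where open TreeGrowth {_#_ = Incomparable P} (Incomparable-sym P) (Incomparable-irrefl P)
proposition3p8 (suc (suc k)) P two =
  Tree⊤⇒IsTwoChain P (subst (Tree (Incomparable P)) U≡⊤ (levelTree (suc k) (s≤s z≤n) ≤-refl))
  where
  open Levels P two
  U≡⊤ : U (suc k) (s≤s z≤n) ≤-refl ≡ ⊤
  U≡⊤ = ∣p∣≡n⇒p≡⊤ (∣union∣≡1+m P (level (suc k) (s≤s z≤n) ≤-refl))
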